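{- Let $\alpha$ be a nonzero integer and let $(h_n)$ be the sequence with $h_0=0$, $h_1=1$, $h_2=-\alpha$, $h_3=-\alpha^3$, $h_4=0$, and for $m\ge2$: $h_{2m+1}=h_{m+2}h_m^3-h_{m-1}h_{m+1}^3$, for $m\ge 3$: $h_{2m}=h_m\big(h_{m+2}h_{m-1}^2-h_{m-2}h_{m+1}^2\big)/h_2$. (i) $h_n$ is a square for all positive integers $n$ not divisible by $4$ if and only if $\alpha$ is a square. (ii) $h_n$ is a cube for all positive integers $n$ not divisible by $4$ if and only if $\alpha$ is a cube.
   Context: The sequence defined is the elliptic divisibility sequence attached to the point $(0,0)$ of order $4$ on $y^2+xy-\alpha y=x^3-\alpha x^2$; $h_n=0$ exactly when $4\mid n$. Convention: an integer $m$ is called a square if $m=\pm\beta^2$ for some nonzero integer $\beta$, and a cube if $m=\beta^3$ for some nonzero integer $\beta$. -}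

module Defs where

open import Data.Nat as ℕ using (ℕ; suc)
open import Data.Integer using (ℤ; +_; -_; _*_; _-_; _^_)
open import Data.Product using (∃-syntax; _×_)
open import Data.Sum using (_⊎_)
open import Relation.Binary.PropositionalEquality using (_≡_; _≢_)

IsSquare : ℤ → Set
IsSquare m = ∃[ β ] (β ≢ + 0 × (m ≡ β ^ 2 ⊎ m ≡ - (β ^ 2)))

IsCube : ℤ → Set
IsCube m = ∃[ β ] (β ≢ + 0 × m ≡ β ^ 3)

-- The even-index recurrence
-- h_{2m} = h_m (h_{m+2} h_{m-1}^2 - h_{m-2} h_{m+1}^2) / h_2 is written
-- multiplied through by h_2 = -α (nonzero, so this determines h_{2m}).
record IsSeq (α : ℤ) (h : ℕ → ℤ) : Set where
  field
    h0 : h 0 ≡ + 0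
    h1 : h 1 ≡ + 1
    h2 : h 2 ≡ - α
    h3 : h 3 ≡ - (α ^ 3)
    h4 : h 4 ≡ + 0
    odd : ∀ (m : ℕ) → 2 ℕ.≤ m →
      h (suc (2 ℕ.* m)) ≡ h (m ℕ.+ 2) * h m ^ 3 - h (m ℕ.∸ 1) * h (m ℕ.+ 1) ^ 3
    even : ∀ (m : ℕ) → 3 ℕ.≤ m →
      h 2 * h (2 ℕ.* m) ≡ h m * (h (m ℕ.+ 2) * h (m ℕ.∸ 1) ^ 2 - h (m ℕ.∸ 2) * h (m ℕ.+ 1) ^ 2)

module Submission where

-- For 4 ∤ n the term h n of the sequence is, up to sign, a power of α,
-- and h n = 0 when 4 ∣ n.  Both equivalences of the theorem follow:
-- squares and cubes (in the signed sense of Defs) are closed under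
-- products and negation, so if α is a square (cube) so is every ±α^k;
-- conversely h 2 = -α, and -α is a square (cube) only if α is.

open import Defs
open import Data.Nat using (ℕ; _<_)
open import Data.Nat.Divisibility using (_∣_)
open import Data.Integer using (ℤ; +_)
open import Data.Product using (_×_)
open import Function.Bundles using (_⇔_)
open import Relation.Nullary using (¬_)
open import Relation.Binary.PropositionalEquality using (_≢_)

import Data.Nat as ℕ
open import Data.Nat using (zero; suc; _∸_; z≤n; s≤s)
import Data.Nat.Properties as ℕP
open import Data.Nat.DivMod using (_%_; _/_; m≡m%n+[m/n]*n; m%n<n)
open import Data.Nat.Divisibility using (m%n≡0⇒n∣m; ∣⇒≤)
open import Data.Nat.Induction using (<-rec)
open import Data.Integer using (_*_; _-_; -_; _^_; ∣_∣; -[1+_])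
open import Data.Integer.Base using (≢-nonZero)
open import Data.Integer.Properties
  using (neg-involutive; neg-injective; neg-distribˡ-*; neg-distribʳ-*; *-identityʳ;
         *-zeroˡ; *-zeroʳ; +-identityˡ; +-identityʳ; *-cancelˡ-≡; abs-*; ^-distribˡ-+-*;
         i*j≡0⇒i≡0∨j≡0)
open import Data.Product using (∃-syntax; _,_; proj₁; proj₂)
open import Data.Sum using (_⊎_; inj₁; inj₂; [_,_]; swap)
open import Data.Empty using (⊥-elim)
open import Function using (_∘_)
open import Function.Bundles using (mk⇔)
open import Relation.Binary.PropositionalEquality
  using (_≡_; refl; sym; trans; cong; subst; subst₂; module ≡-Reasoning)
import Data.Nat.Tactic.RingSolver as ℕSolver
import Data.Integer.Tactic.RingSolver as ℤSolver

-- x ≡± y : x equals y up to sign.  IsSquare m unfolds to ∃ β ≢ 0 with m ≡± β ^ 2.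
infix 4 _≡±_
_≡±_ : ℤ → ℤ → Set
x ≡± y = x ≡ y ⊎ x ≡ - y

≡±-neg : ∀ {x y} → x ≡± y → - x ≡± y
≡±-neg (inj₁ e) = inj₂ (cong -_ e)
≡±-neg (inj₂ e) = inj₁ (trans (cong -_ e) (neg-involutive _))

neg-*-neg : ∀ u v → (- u) * (- v) ≡ u * v
neg-*-neg u v = begin
  (- u) * (- v)   ≡⟨ neg-distribʳ-* (- u) v ⟨
  - ((- u) * v)   ≡⟨ cong -_ (neg-distribˡ-* u v) ⟨
  - - (u * v)     ≡⟨ neg-involutive (u * v) ⟩
  u * v           ∎
  where open ≡-Reasoning

≡±-* : ∀ {x y u v} → x ≡± u → y ≡± v → x * y ≡± u * v
≡±-* (inj₁ refl) (inj₁ refl) = inj₁ refl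
≡±-* {u = u} {v} (inj₁ refl) (inj₂ refl) = inj₂ (sym (neg-distribʳ-* u v))
≡±-* {u = u} {v} (inj₂ refl) (inj₁ refl) = inj₂ (sym (neg-distribˡ-* u v))
≡±-* {u = u} {v} (inj₂ refl) (inj₂ refl) = inj₁ (neg-*-neg u v)

abs≡1⇒≡±1 : ∀ x → ∣ x ∣ ≡ 1 → x ≡± + 1
abs≡1⇒≡±1 (+ 1) _ = inj₁ refl
abs≡1⇒≡±1 -[1+ 0 ] _ = inj₂ refl
abs≡1⇒≡±1 (+ 0) ()
abs≡1⇒≡±1 (+ suc (suc n)) ()
abs≡1⇒≡±1 -[1+ suc n ] ()

record MulClosed (P : ℤ → Set) : Set where
  field
    one : P (+ 1)
    mul : ∀ {x y} → P x → P y → P (x * y)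
    neg : ∀ {x} → P x → P (- x)

nonzero-* : ∀ {β γ} → β ≢ + 0 → γ ≢ + 0 → β * γ ≢ + 0
nonzero-* {β} β≢0 γ≢0 e = [ β≢0 , γ≢0 ] (i*j≡0⇒i≡0∨j≡0 β e)

-- (β γ)² = β² γ², (β γ)³ = β³ γ³ and (-β)³ = -β³, with the powers unfolded
-- (β ^ 2 is definitionally β * (β * 1)) so that the ring solver applies.
square-* : ∀ β γ → (β * γ) * ((β * γ) * + 1) ≡ (β * (β * + 1)) * (γ * (γ * + 1))
square-* = ℤSolver.solve-∀

cube-* : ∀ β γ →
  (β * γ) * ((β * γ) * ((β * γ) * + 1)) ≡ (β * (β * (β * + 1))) * (γ * (γ * (γ * + 1)))
cube-* = ℤSolver.solve-∀

cube-neg : ∀ β → (- β) * ((- β) * ((- β) * + 1)) ≡ - (β * (β * (β * + 1)))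
cube-neg = ℤSolver.solve-∀

squares-closed : MulClosed IsSquare
squares-closed = record
  { one = + 1 , (λ ()) , inj₁ refl
  ; mul = λ { (β , β≢0 , s) (γ , γ≢0 , t) →
              β * γ , nonzero-* β≢0 γ≢0 , subst (_ ≡±_) (sym (square-* β γ)) (≡±-* s t) }
  ; neg = λ { (β , β≢0 , s) → β , β≢0 , ≡±-neg s }
  }

cubes-closed : MulClosed IsCube
cubes-closed = record
  { one = + 1 , (λ ()) , refl
  ; mul = λ { (β , β≢0 , refl) (γ , γ≢0 , refl) → β * γ , nonzero-* β≢0 γ≢0 , sym (cube-* β γ) }
  ; neg = λ { (β , β≢0 , refl) → - β , β≢0 ∘ neg-injective , sym (cube-neg β) }
  }

SignedPower : ℤ → ℤ → Set
SignedPower α x = ∃[ k ] x ≡± α ^ k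

module _ {α : ℤ} where

  power-one : SignedPower α (+ 1)
  power-one = 0 , inj₁ refl

  power-neg : ∀ {x} → SignedPower α x → SignedPower α (- x)
  power-neg (k , s) = k , ≡±-neg s

  power-mul : ∀ {x y} → SignedPower α x → SignedPower α y → SignedPower α (x * y)
  power-mul (k , s) (j , t) = k ℕ.+ j , subst (_ ≡±_) (sym (^-distribˡ-+-* α k j)) (≡±-* s t)

  power-pow : ∀ {x} n → SignedPower α x → SignedPower α (x ^ n)
  power-pow zero _ = power-one
  power-pow (suc n) p = power-mul p (power-pow n p)

  power-base : SignedPower α α
  power-base = 1 , inj₁ (sym (*-identityʳ α))

  power-closed : ∀ {P} → MulClosed P → P α → ∀ {x} → SignedPower α x → P x
  power-closed {P} C pα (k , s) =
    [ (λ e → subst P (sym e) (pow k)) , (λ e → subst P (sym e) (neg (pow k))) ] s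
    where
    open MulClosed C
    pow : ∀ k → P (α ^ k)
    pow zero = one
    pow (suc k) = mul pα (pow k)

  -- If (-α)·x is a signed power of α ≠ 0, then so is x: the division by
  -- h 2 = -α in the even-index recurrence stays within signed powers.
  power-cancel : α ≢ + 0 → ∀ {x y} → - α * x ≡ y → SignedPower α y → SignedPower α x
  power-cancel α≢0 {x} {y} e (zero , s) =
    0 , abs≡1⇒≡±1 x (ℕP.m*n≡1⇒n≡1 ∣ - α ∣ ∣ x ∣ (begin
      ∣ - α ∣ ℕ.* ∣ x ∣   ≡⟨ abs-* (- α) x ⟨
      ∣ - α * x ∣         ≡⟨ cong ∣_∣ e ⟩
      ∣ y ∣               ≡⟨ [ cong ∣_∣ , cong ∣_∣ ] s ⟩
      1                   ∎))
    where open ≡-Reasoning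
  power-cancel α≢0 {x} {y} e (suc j , s) = j , cancel-sign s
    where
    open ≡-Reasoning
    cancel : ∀ w → - α * x ≡ α * w → x ≡ - w
    cancel w e′ = *-cancelˡ-≡ α x (- w) {{≢-nonZero α≢0}} (begin
      α * x         ≡⟨ neg-involutive (α * x) ⟨
      - - (α * x)   ≡⟨ cong -_ (trans (neg-distribˡ-* α x) e′) ⟩
      - (α * w)     ≡⟨ neg-distribʳ-* α w ⟩
      α * - w       ∎)
    cancel-sign : y ≡± α * α ^ j → x ≡± α ^ j
    cancel-sign (inj₁ s′) = inj₂ (cancel (α ^ j) (trans e s′))
    cancel-sign (inj₂ s′) = inj₁ (trans
      (cancel (- α ^ j) (trans e (trans s′ (neg-distribʳ-* α (α ^ j)))))
      (neg-involutive (α ^ j)))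

-- 2 (c + 4r) = 2c + 4·(2r): the index of the block obtained by doubling.
double-index : ∀ c r → 2 ℕ.* (c ℕ.+ r ℕ.* 4) ≡ 2 ℕ.* c ℕ.+ 2 ℕ.* r ℕ.* 4
double-index = ℕSolver.solve-∀

parity : ∀ n → ∃[ r ] (n ≡ 2 ℕ.* r ⊎ n ≡ suc (2 ℕ.* r))
parity zero = 0 , inj₁ refl
parity (suc n) with parity n
... | r , inj₁ e = r , inj₂ (cong suc e)
... | r , inj₂ e = suc r , inj₁ (trans (cong suc e) (cong suc (sym (ℕP.+-suc r (r ℕ.+ 0)))))

module Sequence {α : ℤ} (α≢0 : α ≢ + 0) {h : ℕ → ℤ} (S : IsSeq α h) where
  open IsSeq S
  open ≡-Reasoning

  two≤ : ∀ {k} → 2 ℕ.≤ 4 ℕ.+ k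
  two≤ = s≤s (s≤s z≤n)

  three≤ : ∀ {k} → 3 ℕ.≤ 4 ℕ.+ k
  three≤ = s≤s (s≤s (s≤s z≤n))

  Power : ℤ → Set
  Power = SignedPower α

  -- The recurrences with the indices m + 1, m + 2 written as 1 + m, 2 + m,
  -- so that for m = c + 4r they reduce definitionally to block indices.
  odd-rec : ∀ m → 2 ℕ.≤ m →
    h (suc (2 ℕ.* m)) ≡ h (2 ℕ.+ m) * h m ^ 3 - h (m ∸ 1) * h (1 ℕ.+ m) ^ 3
  odd-rec m le = subst₂ (λ a b → h (suc (2 ℕ.* m)) ≡ h a * h m ^ 3 - h (m ∸ 1) * h b ^ 3)
    (ℕP.+-comm m 2) (ℕP.+-comm m 1) (odd m le)

  even-rec : ∀ m → 3 ℕ.≤ m →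
    - α * h (2 ℕ.* m) ≡ h m * (h (2 ℕ.+ m) * h (m ∸ 1) ^ 2 - h (m ∸ 2) * h (1 ℕ.+ m) ^ 2)
  even-rec m le = subst₂ (λ a b → - α * h (2 ℕ.* m) ≡ h m * (h a * h (m ∸ 1) ^ 2 - h (m ∸ 2) * h b ^ 2))
    (ℕP.+-comm m 2) (ℕP.+-comm m 1) (trans (cong (_* h (2 ℕ.* m)) (sym h2)) (even m le))

  product-vanishes : ∀ a b n → a ≡ + 0 ⊎ b ≡ + 0 → a * b ^ suc n ≡ + 0
  product-vanishes _ b n (inj₁ refl) = *-zeroˡ (b ^ suc n)
  product-vanishes a _ n (inj₂ refl) = trans (cong (a *_) (*-zeroˡ ((+ 0) ^ n))) (*-zeroʳ a)

  minus-zero : ∀ x {y} → y ≡ + 0 → x - y ≡ x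
  minus-zero x refl = +-identityʳ x

  zero-minus : ∀ {x} y → x ≡ + 0 → x - y ≡ - y
  zero-minus y refl = +-identityˡ (- y)

  odd-first : ∀ m {n} → 2 ℕ.≤ m → 2 ℕ.* m ≡ n → h (m ∸ 1) ≡ + 0 ⊎ h (1 ℕ.+ m) ≡ + 0 →
    Power (h (2 ℕ.+ m)) → Power (h m) → Power (h (suc n))
  odd-first m le refl z p q = subst Power (sym (begin
    h (suc (2 ℕ.* m))                                           ≡⟨ odd-rec m le ⟩
    h (2 ℕ.+ m) * h m ^ 3 - h (m ∸ 1) * h (1 ℕ.+ m) ^ 3        ≡⟨ minus-zero _ (product-vanishes (h (m ∸ 1)) (h (1 ℕ.+ m)) 2 z) ⟩
    h (2 ℕ.+ m) * h m ^ 3                                       ∎))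
    (power-mul p (power-pow 3 q))

  odd-second : ∀ m {n} → 2 ℕ.≤ m → 2 ℕ.* m ≡ n → h m ≡ + 0 ⊎ h (2 ℕ.+ m) ≡ + 0 →
    Power (h (m ∸ 1)) → Power (h (1 ℕ.+ m)) → Power (h (suc n))
  odd-second m le refl z p q = subst Power (sym (begin
    h (suc (2 ℕ.* m))                                           ≡⟨ odd-rec m le ⟩
    h (2 ℕ.+ m) * h m ^ 3 - h (m ∸ 1) * h (1 ℕ.+ m) ^ 3        ≡⟨ zero-minus _ (product-vanishes (h (2 ℕ.+ m)) (h m) 2 (swap z)) ⟩
    - (h (m ∸ 1) * h (1 ℕ.+ m) ^ 3)                             ∎))
    (power-neg (power-mul p (power-pow 3 q)))

  cancel-zero : ∀ {x} → - α * x ≡ + 0 → x ≡ + 0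
  cancel-zero {x} e = [ (λ -α≡0 → ⊥-elim (α≢0 (neg-injective -α≡0))) , (λ x≡0 → x≡0) ]
    (i*j≡0⇒i≡0∨j≡0 (- α) e)

  even-zero-middle : ∀ m {n} → 3 ℕ.≤ m → 2 ℕ.* m ≡ n → h m ≡ + 0 → h n ≡ + 0
  even-zero-middle m le refl z = cancel-zero (begin
    - α * h (2 ℕ.* m)   ≡⟨ even-rec m le ⟩
    h m * bracket       ≡⟨ cong (_* bracket) z ⟩
    + 0 * bracket       ≡⟨ *-zeroˡ bracket ⟩
    + 0                 ∎)
    where
    bracket : ℤ
    bracket = h (2 ℕ.+ m) * h (m ∸ 1) ^ 2 - h (m ∸ 2) * h (1 ℕ.+ m) ^ 2

  even-zero-ends : ∀ m {n} → 3 ℕ.≤ m → 2 ℕ.* m ≡ n → h (2 ℕ.+ m) ≡ + 0 → h (m ∸ 2) ≡ + 0 →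
    h n ≡ + 0
  even-zero-ends m le refl z₊ z₋ = cancel-zero (begin
    - α * h (2 ℕ.* m)                                                    ≡⟨ even-rec m le ⟩
    h m * (h (2 ℕ.+ m) * h (m ∸ 1) ^ 2 - h (m ∸ 2) * h (1 ℕ.+ m) ^ 2)   ≡⟨ cong (h m *_) (minus-zero _ (product-vanishes (h (m ∸ 2)) (h (1 ℕ.+ m)) 1 (inj₁ z₋))) ⟩
    h m * (h (2 ℕ.+ m) * h (m ∸ 1) ^ 2)                                  ≡⟨ cong (h m *_) (product-vanishes (h (2 ℕ.+ m)) (h (m ∸ 1)) 1 (inj₁ z₊)) ⟩
    h m * + 0                                                            ≡⟨ *-zeroʳ (h m) ⟩
    + 0                                                                  ∎)

  even-first : ∀ m {n} → 3 ℕ.≤ m → 2 ℕ.* m ≡ n → h (1 ℕ.+ m) ≡ + 0 →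
    Power (h m) → Power (h (2 ℕ.+ m)) → Power (h (m ∸ 1)) → Power (h n)
  even-first m le refl z p q r = power-cancel α≢0 (begin
    - α * h (2 ℕ.* m)                                                    ≡⟨ even-rec m le ⟩
    h m * (h (2 ℕ.+ m) * h (m ∸ 1) ^ 2 - h (m ∸ 2) * h (1 ℕ.+ m) ^ 2)   ≡⟨ cong (h m *_) (minus-zero _ (product-vanishes (h (m ∸ 2)) (h (1 ℕ.+ m)) 1 (inj₂ z))) ⟩
    h m * (h (2 ℕ.+ m) * h (m ∸ 1) ^ 2)                                  ∎)
    (power-mul p (power-mul q (power-pow 2 r)))

  even-second : ∀ m {n} → 3 ℕ.≤ m → 2 ℕ.* m ≡ n → h (m ∸ 1) ≡ + 0 →
    Power (h m) → Power (h (m ∸ 2)) → Power (h (1 ℕ.+ m)) → Power (h n)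
  even-second m le refl z p q r = power-cancel α≢0 (begin
    - α * h (2 ℕ.* m)                                                    ≡⟨ even-rec m le ⟩
    h m * (h (2 ℕ.+ m) * h (m ∸ 1) ^ 2 - h (m ∸ 2) * h (1 ℕ.+ m) ^ 2)   ≡⟨ cong (h m *_) (zero-minus _ (product-vanishes (h (2 ℕ.+ m)) (h (m ∸ 1)) 1 (inj₂ z))) ⟩
    h m * - (h (m ∸ 2) * h (1 ℕ.+ m) ^ 2)                                ∎)
    (power-mul p (power-neg (power-mul q (power-pow 2 r))))

  Block : ℕ → Set
  Block q = h (q ℕ.* 4) ≡ + 0
          × Power (h (1 ℕ.+ q ℕ.* 4)) × Power (h (2 ℕ.+ q ℕ.* 4)) × Power (h (3 ℕ.+ q ℕ.* 4))

  block-0 : Block 0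
  block-0 = h0 , subst Power (sym h1) power-one , subst Power (sym h2) (power-neg power-base) , h₃
    where
    h₃ : Power (h 3)
    h₃ = 3 , inj₂ h3

  block-1 : Block 1
  block-1 = h4 , h₅ , h₆ , h₇
    where
    h₁ = proj₁ (proj₂ block-0)
    h₂ = proj₁ (proj₂ (proj₂ block-0))
    h₃ = proj₂ (proj₂ (proj₂ block-0))
    h₅ : Power (h 5)
    h₅ = odd-second 2 (s≤s (s≤s z≤n)) refl (inj₂ h4) h₁ h₃
    h₆ : Power (h 6)
    h₆ = even-first 3 (s≤s (s≤s (s≤s z≤n))) refl h4 h₃ h₅ h₂
    h₇ : Power (h 7)
    h₇ = odd-first 3 (s≤s (s≤s z≤n)) refl (inj₂ h4) h₅ h₃

  double-even : ∀ r → Block r → Block (suc r) → Block (2 ℕ.+ 2 ℕ.* r)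
  double-even r (_ , _ , _ , h₃) (z₄ , h₅ , h₆ , h₇) =
      even-zero-middle (4 ℕ.+ r ℕ.* 4) three≤ (double-index 4 r) z₄
    , odd-second (4 ℕ.+ r ℕ.* 4) two≤ (double-index 4 r) (inj₁ z₄) h₃ h₅
    , even-second (5 ℕ.+ r ℕ.* 4) three≤ (double-index 5 r) z₄ h₅ h₃ h₆
    , odd-first (5 ℕ.+ r ℕ.* 4) two≤ (double-index 5 r) (inj₁ z₄) h₇ h₅

  double-odd : ∀ r → Block (suc r) → Block (2 ℕ.+ r) → Block (3 ℕ.+ 2 ℕ.* r)
  double-odd r (z₄ , h₅ , h₆ , h₇) (z₈ , h₉ , _ , _) =
      even-zero-ends (6 ℕ.+ r ℕ.* 4) three≤ (double-index 6 r) z₈ z₄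
    , odd-second (6 ℕ.+ r ℕ.* 4) two≤ (double-index 6 r) (inj₂ z₈) h₅ h₇
    , even-first (7 ℕ.+ r ℕ.* 4) three≤ (double-index 7 r) z₈ h₇ h₉ h₆
    , odd-first (7 ℕ.+ r ℕ.* 4) two≤ (double-index 7 r) (inj₂ z₈) h₉ h₇

  all-blocks : ∀ q → Block q
  all-blocks = <-rec Block step
    where
    step : ∀ q → (∀ {p} → p < q → Block p) → Block q
    step zero _ = block-0
    step (suc zero) _ = block-1
    step (suc (suc q)) ih with parity q
    ... | r , inj₁ refl = double-even r (ih (s≤s (ℕP.m≤n⇒m≤1+n (ℕP.m≤m+n r _))))
                                        (ih (s≤s (s≤s (ℕP.m≤m+n r _))))
    ... | r , inj₂ refl = double-odd r (ih (s≤s (s≤s (ℕP.m≤n⇒m≤1+n (ℕP.m≤m+n r _)))))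
                                       (ih (s≤s (s≤s (s≤s (ℕP.m≤m+n r _)))))

  in-block : ∀ q j → j < 4 → j ≢ 0 → Power (h (j ℕ.+ q ℕ.* 4))
  in-block q 0 _ j≢0 = ⊥-elim (j≢0 refl)
  in-block q 1 _ _ = proj₁ (proj₂ (all-blocks q))
  in-block q 2 _ _ = proj₁ (proj₂ (proj₂ (all-blocks q)))
  in-block q 3 _ _ = proj₂ (proj₂ (proj₂ (all-blocks q)))
  in-block q (suc (suc (suc (suc _)))) (s≤s (s≤s (s≤s (s≤s ())))) _

  power-at : ∀ n → ¬ (4 ∣ n) → Power (h n)
  power-at n 4∤n = subst (Power ∘ h) (sym (m≡m%n+[m/n]*n n 4))
    (in-block (n / 4) (n % 4) (m%n<n n 4) (4∤n ∘ m%n≡0⇒n∣m n 4))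

  characterisation : ∀ {P} → MulClosed P →
    (∀ (n : ℕ) → 0 < n → ¬ (4 ∣ n) → P (h n)) ⇔ P α
  characterisation {P} C = mk⇔ from-h₂ (λ pα n _ 4∤n → power-closed C pα (power-at n 4∤n))
    where
    4∤2 : ¬ (4 ∣ 2)
    4∤2 4∣2 with ∣⇒≤ 4∣2
    ... | s≤s (s≤s ())
    from-h₂ : (∀ (n : ℕ) → 0 < n → ¬ (4 ∣ n) → P (h n)) → P α
    from-h₂ all = subst P (neg-involutive α) (MulClosed.neg C (subst P h2 (all 2 (s≤s z≤n) 4∤2)))

theorem5p2 : (α : ℤ) → α ≢ + 0 → (h : ℕ → ℤ) → IsSeq α h →
    (((∀ (n : ℕ) → 0 < n → ¬ (4 ∣ n) → IsSquare (h n)) ⇔ IsSquare α)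
    × ((∀ (n : ℕ) → 0 < n → ¬ (4 ∣ n) → IsCube (h n)) ⇔ IsCube α))
theorem5p2 α α≢0 h S = characterisation squares-closed , characterisation cubes-closed
  where open Sequence α≢0 S
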